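{- Let $p\ge1$ be an integer. The matrix $(L(n,k,0,p))_{n,k\ge0}$ is the unique infinite matrix $(a(n,k))_{n,k\ge0}$ such that (i) for every $k\ge0$ there is an integer $i$ with $a(n,k)=e(n,k,i,p)$ for all $n\ge0$, and (ii) $a(n,n)=1$ for all $n\ge0$.
   Context: $e(n,k,i,p)$ is the number of $k$-subsets of $\{1,\dots,n\}$ whose sum of elements is congruent to $i$ modulo $p$ (the empty set has sum $0$). $\begin{bmatrix}n\\k\end{bmatrix}_q$ is the Gaussian binomial coefficient (zero for $k>n$). For a polynomial $f\in\mathbb Z[q]$, let $\overline f$ be the unique polynomial of degree $<p$ with $f\equiv\overline f\pmod{q^p-1}$. The $p$-Losanitsch numbers are $L(n,k,j,p)=[q^j]\,\overline{\begin{bmatrix}n\\k\end{bmatrix}_q}$ for $0\le j\le p-1$, i.e. $\sum_{j=0}^{p-1}L(n,k,j,p)q^j\equiv\begin{bmatrix}n\\k\end{bmatrix}_q\pmod{q^p-1}$. -}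

module Defs where

open import Data.Nat using (ℕ; zero; suc; _+_; _≟_; NonZero)
open import Data.Nat.DivMod using (_%_)
open import Data.Nat.Divisibility using (_∣?_)
open import Data.Integer as ℤ using (ℤ; +_; ∣_∣)
open import Data.List using (List; []; _∷_; _++_; map; length; filter; replicate)
open import Data.Nat.ListAction using (sum)
open import Data.Bool using (true; false)
open import Relation.Nullary using (does)
open import Relation.Nullary.Decidable using (_×-dec_)

subsets : ℕ → List (List ℕ)
subsets zero    = [] ∷ []
subsets (suc n) = subsets n ++ map (suc n ∷_) (subsets n)

-- e(n,k,i,p): number of k-subsets of {1..n} whose element sum s satisfies
-- s ≡ i (mod p), i.e. p ∣ (s - i) in ℤ  (ℤ-divisibility is divisibility of absolute values).
e : ℕ → ℕ → ℤ → ℕ → ℕ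
e n k i p = length (filter (λ s → (length s ≟ k) ×-dec (p ∣? ∣ (+ sum s) ℤ.- i ∣)) (subsets n))

-- Polynomials in ℤ[q] with natural coefficients as coefficient lists (index = exponent).
_⊕_ : List ℕ → List ℕ → List ℕ
[]       ⊕ g        = g
(a ∷ f)  ⊕ []       = a ∷ f
(a ∷ f)  ⊕ (b ∷ g)  = (a + b) ∷ (f ⊕ g)

shift : ℕ → List ℕ → List ℕ
shift m f = replicate m 0 ++ f

-- Gaussian binomial [n choose k]_q via q-Pascal recursion
-- [n+1, k+1] = [n, k] + q^(k+1) [n, k+1], [n,0] = 1, [0,k+1] = 0.
gauss : ℕ → ℕ → List ℕ
gauss n       zero    = 1 ∷ []
gauss zero    (suc k) = []
gauss (suc n) (suc k) = gauss n k ⊕ shift (suc k) (gauss n (suc k))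

coeffSumMod : (p : ℕ) .{{_ : NonZero p}} → ℕ → ℕ → List ℕ → ℕ
coeffSumMod p j m []      = 0
coeffSumMod p j m (a ∷ f) with does (m % p ≟ j)
... | true  = a + coeffSumMod p j (suc m) f
... | false = coeffSumMod p j (suc m) f

-- L(n,k,j,p) = [q^j] of the reduction of [n choose k]_q modulo q^p - 1
L : ℕ → ℕ → ℕ → (p : ℕ) .{{_ : NonZero p}} → ℕ
L n k j p = coeffSumMod p j 0 (gauss n k)

module Submission where

-- Splitting according to whether 1 ∈ A gives a recursion
-- (subsetSum-split-one) which, compared with the q-Pascal recursion defining gauss, yields the
-- classical generating function of subset sums: for every predicate g on ℕ,
--   #{A ⊆ {1..n} : |A| = k, g(ΣA)} = Σ_j [q^j] [n,k]_q · [g(T_k + j)],   T_k = 1+2+…+k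
-- (subsetCount-gauss).  Consequences, with g(s) = "s ≡ i (mod p)":
--  * i = T_k turns [g(T_k + j)] into [p ∣ j], so L(n,k,0,p) = e(n,k,T_k,p)   (condition (i));
--  * [n,n]_q = 1, so L(n,n,0,p) = 1                                            (condition (ii));
--  * e(k,k,i,p) = [T_k ≡ i (mod p)], since {1..k} is the only k-subset of {1..k}.  Hence a
--    matrix with a(k,k) = 1 whose column k is e(·,k,i,p) has i ≡ T_k, and e(n,k,i,p) depends
--    on i only modulo p, so that column equals e(·,k,T_k,p) = L(·,k,0,p)        (uniqueness).

open import Defs
open import Data.Nat using (ℕ; NonZero)
open import Data.Integer using (ℤ)
open import Data.Product using (Σ; _×_)
open import Relation.Binary.PropositionalEquality using (_≡_)

open import Data.Nat using (zero; suc; _+_; _%_; _<_; _≟_; s≤s)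
import Data.Nat.Properties as ℕP
open import Data.Nat.DivMod using (m*n%n≡0)
open import Data.Nat.Divisibility using (_∣_; _∣?_; m%n≡0⇔n∣m)
import Data.Integer as ℤ
import Data.Integer.Properties as ℤP
import Data.Integer.Divisibility.Signed as ℤ∣
import Data.Integer.Tactic.RingSolver as ℤRing
open import Data.Nat.Tactic.RingSolver using (solve-∀)
open import Algebra.Properties.CommutativeSemigroup ℕP.+-commutativeSemigroup using (interchange)
open import Data.List using (List; []; _∷_; _++_; map; length; filter)
open import Data.Nat.ListAction using (sum)
open import Data.Bool using (Bool; true; false; if_then_else_; _∧_; T)
open import Data.Unit using (tt)
open import Data.Product using (_,_; proj₁; proj₂)
open import Function.Bundles using (mk⇔)
open import Relation.Nullary using (does; Dec; yes; no)
open import Relation.Nullary.Decidable using (_×-dec_; does-⇔)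
open import Relation.Binary.PropositionalEquality using (refl; sym; trans; cong; cong₂; subst; module ≡-Reasoning)

[_] : Bool → ℕ
[ b ] = if b then 1 else 0

sumOver : List (List ℕ) → (ℕ → ℕ → ℕ) → ℕ
sumOver []       f = 0
sumOver (A ∷ As) f = f (length A) (sum A) + sumOver As f

sumOver-++ : ∀ As Bs f → sumOver (As ++ Bs) f ≡ sumOver As f + sumOver Bs f
sumOver-++ []       Bs f = refl
sumOver-++ (A ∷ As) Bs f =
  trans (cong (f (length A) (sum A) +_) (sumOver-++ As Bs f))
        (sym (ℕP.+-assoc (f (length A) (sum A)) (sumOver As f) (sumOver Bs f)))

sumOver-insert : ∀ x As f → sumOver (map (x ∷_) As) f ≡ sumOver As (λ l s → f (suc l) (x + s))
sumOver-insert x []       f = refl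
sumOver-insert x (A ∷ As) f = cong (f (suc (length A)) (x + sum A) +_) (sumOver-insert x As f)

sumOver-cong : ∀ As {f g} → (∀ l s → f l s ≡ g l s) → sumOver As f ≡ sumOver As g
sumOver-cong []       f≗g = refl
sumOver-cong (A ∷ As) f≗g = cong₂ _+_ (f≗g (length A) (sum A)) (sumOver-cong As f≗g)

sumOver-zero : ∀ As → sumOver As (λ _ _ → 0) ≡ 0
sumOver-zero []       = refl
sumOver-zero (A ∷ As) = sumOver-zero As

subsetSum : ℕ → (ℕ → ℕ → ℕ) → ℕ
subsetSum n f = sumOver (subsets n) f

subsetSum-split-last : ∀ n f →
  subsetSum (suc n) f ≡ subsetSum n f + subsetSum n (λ l s → f (suc l) (suc n + s))
subsetSum-split-last n f =
  trans (sumOver-++ (subsets n) _ f) (cong (subsetSum n f +_) (sumOver-insert (suc n) (subsets n) f))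

reindex₁ : ∀ n s l → suc (suc n) + (s + l) ≡ (suc n + s) + suc l
reindex₁ = solve-∀

reindex₂ : ∀ n s l → suc (suc n) + suc (s + l) ≡ suc ((suc n + s) + suc l)
reindex₂ = solve-∀

-- Splitting according to whether 1 ∈ A.  Removing 1 and lowering the other elements by one
-- identifies such A with subsets B of {1..n}, and ΣA = ΣB + |B| or ΣA = 1 + ΣB + |B|.
-- Proved by induction on n, commuting this split with the split on the last element.
subsetSum-split-one : ∀ n f →
  subsetSum (suc n) f ≡ subsetSum n (λ l s → f l (s + l)) + subsetSum n (λ l s → f (suc l) (suc (s + l)))
subsetSum-split-one zero    f = sym (ℕP.+-assoc (f 0 0) 0 (f 1 1 + 0))
subsetSum-split-one (suc n) f = begin
  subsetSum (suc (suc n)) f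
    ≡⟨ subsetSum-split-last (suc n) f ⟩
  subsetSum (suc n) f + subsetSum (suc n) withLast
    ≡⟨ cong₂ _+_ (subsetSum-split-one n f) (subsetSum-split-one n withLast) ⟩
  (subsetSum n without1 + subsetSum n with1)
    + (subsetSum n (λ l s → withLast l (s + l)) + subsetSum n (λ l s → withLast (suc l) (suc (s + l))))
    ≡⟨ interchange (subsetSum n without1) (subsetSum n with1) _ _ ⟩
  (subsetSum n without1 + subsetSum n (λ l s → withLast l (s + l)))
    + (subsetSum n with1 + subsetSum n (λ l s → withLast (suc l) (suc (s + l))))
    ≡⟨ cong₂ _+_ (cong (subsetSum n without1 +_) (sumOver-cong (subsets n) λ l s → cong (f (suc l)) (reindex₁ n s l)))
                 (cong (subsetSum n with1 +_) (sumOver-cong (subsets n) λ l s → cong (f (suc (suc l))) (reindex₂ n s l))) ⟩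
  (subsetSum n without1 + subsetSum n (λ l s → without1 (suc l) (suc n + s)))
    + (subsetSum n with1 + subsetSum n (λ l s → with1 (suc l) (suc n + s)))
    ≡⟨ sym (cong₂ _+_ (subsetSum-split-last n without1) (subsetSum-split-last n with1)) ⟩
  subsetSum (suc n) without1 + subsetSum (suc n) with1 ∎
  where
  open ≡-Reasoning
  withLast without1 with1 : ℕ → ℕ → ℕ
  withLast l s = f (suc l) (suc (suc n) + s)
  without1 l s = f l (s + l)
  with1    l s = f (suc l) (suc (s + l))

coeffSumBy : (ℕ → Bool) → ℕ → List ℕ → ℕ
coeffSumBy g m []      = 0
coeffSumBy g m (a ∷ f) = (if g m then a else 0) + coeffSumBy g (suc m) f

coeffSumBy-⊕ : ∀ g m f h → coeffSumBy g m (f ⊕ h) ≡ coeffSumBy g m f + coeffSumBy g m h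
coeffSumBy-⊕ g m []      h       = refl
coeffSumBy-⊕ g m (a ∷ f) []      = sym (ℕP.+-identityʳ _)
coeffSumBy-⊕ g m (a ∷ f) (b ∷ h) = begin
  (if g m then a + b else 0) + coeffSumBy g (suc m) (f ⊕ h)
    ≡⟨ cong₂ _+_ (if-+ (g m)) (coeffSumBy-⊕ g (suc m) f h) ⟩
  ((if g m then a else 0) + (if g m then b else 0)) + (coeffSumBy g (suc m) f + coeffSumBy g (suc m) h)
    ≡⟨ interchange (if g m then a else 0) _ _ _ ⟩
  ((if g m then a else 0) + coeffSumBy g (suc m) f) + ((if g m then b else 0) + coeffSumBy g (suc m) h) ∎
  where
  open ≡-Reasoning
  if-+ : ∀ c → (if c then a + b else 0) ≡ (if c then a else 0) + (if c then b else 0)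
  if-+ true  = refl
  if-+ false = refl

coeffSumBy-shift : ∀ g m c f → coeffSumBy g m (shift c f) ≡ coeffSumBy g (c + m) f
coeffSumBy-shift g m zero    f = refl
coeffSumBy-shift g m (suc c) f =
  trans (cong₂ _+_ (if-0 (g m)) (coeffSumBy-shift g (suc m) c f))
        (cong (λ x → coeffSumBy g x f) (ℕP.+-suc c m))
  where
  if-0 : ∀ b → (if b then 0 else 0) ≡ 0
  if-0 true  = refl
  if-0 false = refl

coeffSumBy-translate : ∀ g c m f → coeffSumBy (λ x → g (x + c)) m f ≡ coeffSumBy g (m + c) f
coeffSumBy-translate g c m []      = refl
coeffSumBy-translate g c m (a ∷ f) = cong ((if g (m + c) then a else 0) +_) (coeffSumBy-translate g c (suc m) f)

coeffSumBy-cong : ∀ {g g′} → (∀ x → g x ≡ g′ x) → ∀ m f → coeffSumBy g m f ≡ coeffSumBy g′ m f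
coeffSumBy-cong g≗g′ m []      = refl
coeffSumBy-cong g≗g′ m (a ∷ f) =
  cong₂ _+_ (cong (λ b → if b then a else 0) (g≗g′ m)) (coeffSumBy-cong g≗g′ (suc m) f)

coeffSumBy-gauss-above : ∀ n k → n < k → ∀ g m → coeffSumBy g m (gauss n k) ≡ 0
coeffSumBy-gauss-above zero    (suc k) _        g m = refl
coeffSumBy-gauss-above (suc n) (suc k) (s≤s n<k) g m =
  trans (coeffSumBy-⊕ g m (gauss n k) (shift (suc k) (gauss n (suc k))))
        (cong₂ _+_ (coeffSumBy-gauss-above n k n<k g m)
                   (trans (coeffSumBy-shift g m (suc k) (gauss n (suc k)))
                          (coeffSumBy-gauss-above n (suc k) (ℕP.m<n⇒m<1+n n<k) g (suc k + m))))

coeffSumBy-gauss-diagonal : ∀ n g m → coeffSumBy g m (gauss n n) ≡ [ g m ]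
coeffSumBy-gauss-diagonal zero    g m = ℕP.+-identityʳ _
coeffSumBy-gauss-diagonal (suc n) g m = begin
  coeffSumBy g m (gauss n n ⊕ shift (suc n) (gauss n (suc n)))
    ≡⟨ coeffSumBy-⊕ g m (gauss n n) _ ⟩
  coeffSumBy g m (gauss n n) + coeffSumBy g m (shift (suc n) (gauss n (suc n)))
    ≡⟨ cong₂ _+_ (coeffSumBy-gauss-diagonal n g m) (coeffSumBy-shift g m (suc n) (gauss n (suc n))) ⟩
  [ g m ] + coeffSumBy g (suc n + m) (gauss n (suc n))
    ≡⟨ cong ([ g m ] +_) (coeffSumBy-gauss-above n (suc n) (ℕP.n<1+n n) g (suc n + m)) ⟩
  [ g m ] + 0
    ≡⟨ ℕP.+-identityʳ _ ⟩
  [ g m ] ∎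
  where open ≡-Reasoning

-- Triangular numbers T_k = 1 + 2 + … + k, the sum of the smallest k-subset {1..k}.
tri : ℕ → ℕ
tri zero    = 0
tri (suc k) = tri k + suc k

coeffSumBy-gauss-pascal : ∀ n k g →
  coeffSumBy g (tri (suc k)) (gauss (suc n) (suc k))
    ≡ coeffSumBy (λ x → g (x + suc k)) (tri (suc k)) (gauss n (suc k)) + coeffSumBy (λ x → g (x + suc k)) (tri k) (gauss n k)
coeffSumBy-gauss-pascal n k g = begin
  coeffSumBy g T₊ (gauss n k ⊕ shift (suc k) (gauss n (suc k)))
    ≡⟨ coeffSumBy-⊕ g T₊ (gauss n k) (shift (suc k) (gauss n (suc k))) ⟩
  coeffSumBy g T₊ (gauss n k) + coeffSumBy g T₊ (shift (suc k) (gauss n (suc k)))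
    ≡⟨ cong (coeffSumBy g T₊ (gauss n k) +_) (coeffSumBy-shift g T₊ (suc k) (gauss n (suc k))) ⟩
  coeffSumBy g T₊ (gauss n k) + coeffSumBy g (suc k + T₊) (gauss n (suc k))
    ≡⟨ cong (λ x → coeffSumBy g T₊ (gauss n k) + coeffSumBy g x (gauss n (suc k))) (ℕP.+-comm (suc k) T₊) ⟩
  coeffSumBy g T₊ (gauss n k) + coeffSumBy g (T₊ + suc k) (gauss n (suc k))
    ≡⟨ ℕP.+-comm (coeffSumBy g T₊ (gauss n k)) _ ⟩
  coeffSumBy g (T₊ + suc k) (gauss n (suc k)) + coeffSumBy g (tri k + suc k) (gauss n k)
    ≡⟨ sym (cong₂ _+_ (coeffSumBy-translate g (suc k) T₊ (gauss n (suc k)))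
                      (coeffSumBy-translate g (suc k) (tri k) (gauss n k))) ⟩
  coeffSumBy (λ x → g (x + suc k)) T₊ (gauss n (suc k)) + coeffSumBy (λ x → g (x + suc k)) (tri k) (gauss n k) ∎
  where
  open ≡-Reasoning
  T₊ : ℕ
  T₊ = tri (suc k)

sizeAndSum : ℕ → (ℕ → Bool) → ℕ → ℕ → ℕ
sizeAndSum k g l s = [ does (l ≟ k) ∧ g s ]

sizeAndSum-cong : ∀ k l {b c : Bool} → (l ≡ k → b ≡ c) → [ does (l ≟ k) ∧ b ] ≡ [ does (l ≟ k) ∧ c ]
sizeAndSum-cong k l b⇔c = guarded (does (l ≟ k)) (λ size → b⇔c (ℕP.≡ᵇ⇒≡ l k size))
  where
  guarded : ∀ d {b c} → (T d → b ≡ c) → [ d ∧ b ] ≡ [ d ∧ c ]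
  guarded true  agree = cong [_] (agree tt)
  guarded false _   = refl

-- Induction on n via subsetSum-split-one: subsets avoiding 1 contribute [n-1,k]_q with the
-- condition translated by k, subsets containing 1 contribute [n-1,k-1]_q likewise; this
-- matches the q-Pascal recursion [n,k]_q = [n-1,k-1]_q + q^k [n-1,k]_q.
subsetCount-gauss : ∀ n k g → subsetSum n (sizeAndSum k g) ≡ coeffSumBy g (tri k) (gauss n k)
subsetCount-gauss zero    zero    g = refl
subsetCount-gauss zero    (suc k) g = refl
subsetCount-gauss (suc n) zero    g = begin
  subsetSum (suc n) (sizeAndSum 0 g)
    ≡⟨ subsetSum-split-one n (sizeAndSum 0 g) ⟩
  subsetSum n (λ l s → sizeAndSum 0 g l (s + l)) + subsetSum n (λ _ _ → 0)
    ≡⟨ cong₂ _+_ (sumOver-cong (subsets n) emptySum) (sumOver-zero (subsets n)) ⟩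
  subsetSum n (sizeAndSum 0 g) + 0
    ≡⟨ ℕP.+-identityʳ _ ⟩
  subsetSum n (sizeAndSum 0 g)
    ≡⟨ subsetCount-gauss n zero g ⟩
  [ g 0 ] + 0 ∎
  where
  open ≡-Reasoning
  emptySum : ∀ l s → sizeAndSum 0 g l (s + l) ≡ sizeAndSum 0 g l s
  emptySum zero    s = cong (λ x → [ g x ]) (ℕP.+-identityʳ s)
  emptySum (suc l) s = refl
subsetCount-gauss (suc n) (suc k) g = begin
  subsetSum (suc n) (sizeAndSum (suc k) g)
    ≡⟨ subsetSum-split-one n (sizeAndSum (suc k) g) ⟩
  subsetSum n (λ l s → sizeAndSum (suc k) g l (s + l)) + subsetSum n (λ l s → sizeAndSum (suc k) g (suc l) (suc (s + l)))
    ≡⟨ cong₂ _+_ (sumOver-cong (subsets n) without1) (sumOver-cong (subsets n) with1) ⟩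
  subsetSum n (sizeAndSum (suc k) g′) + subsetSum n (sizeAndSum k g′)
    ≡⟨ cong₂ _+_ (subsetCount-gauss n (suc k) g′) (subsetCount-gauss n k g′) ⟩
  coeffSumBy g′ (tri (suc k)) (gauss n (suc k)) + coeffSumBy g′ (tri k) (gauss n k)
    ≡⟨ sym (coeffSumBy-gauss-pascal n k g) ⟩
  coeffSumBy g (tri (suc k)) (gauss (suc n) (suc k)) ∎
  where
  open ≡-Reasoning
  g′ : ℕ → Bool
  g′ x = g (x + suc k)
  without1 : ∀ l s → sizeAndSum (suc k) g l (s + l) ≡ sizeAndSum (suc k) g′ l s
  without1 l s = sizeAndSum-cong (suc k) l (λ l≡1+k → cong (λ x → g (s + x)) l≡1+k)
  with1 : ∀ l s → sizeAndSum (suc k) g (suc l) (suc (s + l)) ≡ sizeAndSum k g′ l s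
  with1 l s = sizeAndSum-cong k l (λ l≡k → cong g (trans (sym (ℕP.+-suc s l)) (cong (λ x → s + suc x) l≡k)))

length-filter-sumOver : {P : ℕ → ℕ → Set} (P? : ∀ l s → Dec (P l s)) → ∀ As →
  length (filter (λ A → P? (length A) (sum A)) As) ≡ sumOver As (λ l s → [ does (P? l s) ])
length-filter-sumOver P? []       = refl
length-filter-sumOver P? (A ∷ As) with does (P? (length A) (sum A))
... | true  = cong suc (length-filter-sumOver P? As)
... | false = length-filter-sumOver P? As

congruentTo : ℕ → ℤ → ℕ → Bool
congruentTo p i s = does (p ∣? ℤ.∣ ℤ.+ s ℤ.- i ∣)

e-gauss : ∀ n k i p → e n k i p ≡ coeffSumBy (congruentTo p i) (tri k) (gauss n k)
e-gauss n k i p =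
  trans (length-filter-sumOver (λ l s → (l ≟ k) ×-dec (p ∣? ℤ.∣ ℤ.+ s ℤ.- i ∣)) (subsets n))
        (subsetCount-gauss n k (congruentTo p i))

coeffSumMod-coeffSumBy : (p : ℕ) .{{_ : NonZero p}} → ∀ j m f →
  coeffSumMod p j m f ≡ coeffSumBy (λ x → does (x % p ≟ j)) m f
coeffSumMod-coeffSumBy p j m []      = refl
coeffSumMod-coeffSumBy p j m (a ∷ f) with does (m % p ≟ j)
... | true  = cong (a +_) (coeffSumMod-coeffSumBy p j (suc m) f)
... | false = coeffSumMod-coeffSumBy p j (suc m) f

∣s+t-t∣≡s : ∀ s t → ℤ.∣ ℤ.+ (s + t) ℤ.- ℤ.+ t ∣ ≡ s
∣s+t-t∣≡s s t =
  trans (cong ℤ.∣_∣ (trans (ℤP.m-n≡m⊖n (s + t) t) (ℤP.⊖-≥ (ℕP.m≤n+m t s)))) (ℕP.m+n∸n≡m s t)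

-- Condition (i) for L: column k of L is e(·,k,T_k,p), because s + T_k ≡ T_k iff p ∣ s.
L-column : (p : ℕ) .{{_ : NonZero p}} → ∀ n k → L n k 0 p ≡ e n k (ℤ.+ tri k) p
L-column p n k = begin
  L n k 0 p
    ≡⟨ coeffSumMod-coeffSumBy p 0 0 (gauss n k) ⟩
  coeffSumBy (λ x → does (x % p ≟ 0)) 0 (gauss n k)
    ≡⟨ coeffSumBy-cong divisible 0 (gauss n k) ⟩
  coeffSumBy (λ x → congruentTo p (ℤ.+ tri k) (x + tri k)) 0 (gauss n k)
    ≡⟨ coeffSumBy-translate (congruentTo p (ℤ.+ tri k)) (tri k) 0 (gauss n k) ⟩
  coeffSumBy (congruentTo p (ℤ.+ tri k)) (tri k) (gauss n k)
    ≡⟨ sym (e-gauss n k (ℤ.+ tri k) p) ⟩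
  e n k (ℤ.+ tri k) p ∎
  where
  open ≡-Reasoning
  divisible : ∀ x → does (x % p ≟ 0) ≡ congruentTo p (ℤ.+ tri k) (x + tri k)
  divisible x = trans (does-⇔ (m%n≡0⇔n∣m x p) (x % p ≟ 0) (p ∣? x))
                      (cong (λ y → does (p ∣? y)) (sym (∣s+t-t∣≡s x (tri k))))

L-diagonal : (p : ℕ) .{{_ : NonZero p}} → ∀ n → L n n 0 p ≡ 1
L-diagonal p n = begin
  L n n 0 p                                           ≡⟨ coeffSumMod-coeffSumBy p 0 0 (gauss n n) ⟩
  coeffSumBy (λ x → does (x % p ≟ 0)) 0 (gauss n n)   ≡⟨ coeffSumBy-gauss-diagonal n _ 0 ⟩
  [ does (0 % p ≟ 0) ]                                ≡⟨ cong (λ r → [ does (r ≟ 0) ]) (m*n%n≡0 0 p) ⟩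
  1 ∎
  where open ≡-Reasoning

-- e(k,k,i,p) = 1 forces T_k ≡ i (mod p): {1..k} is the only k-subset of {1..k}.
e-diagonal⇒congruent : ∀ k i p → e k k i p ≡ 1 → p ∣ ℤ.∣ ℤ.+ tri k ℤ.- i ∣
e-diagonal⇒congruent k i p e≡1 =
  fromIndicator (p ∣? _) (trans (sym e≡1) (trans (e-gauss k k i p) (coeffSumBy-gauss-diagonal k _ (tri k))))
  where
  fromIndicator : ∀ {A : Set} (A? : Dec A) → 1 ≡ [ does A? ] → A
  fromIndicator (yes a) _  = a
  fromIndicator (no  _) ()

congruentTo-cong : ∀ p i t → p ∣ ℤ.∣ ℤ.+ t ℤ.- i ∣ → ∀ s → congruentTo p i s ≡ congruentTo p (ℤ.+ t) s
congruentTo-cong p i t p∣t-i s = does-⇔ (mk⇔ forth back) (p ∣? _) (p ∣? _)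
  where
  P = ℤ.+ p
  fromUnsigned : ∀ x → p ∣ ℤ.∣ x ∣ → P ℤ∣.∣ x
  fromUnsigned x = ℤ∣.∣ᵤ⇒∣ {P} {x}
  t-i : P ℤ∣.∣ (ℤ.+ t ℤ.- i)
  t-i = fromUnsigned (ℤ.+ t ℤ.- i) p∣t-i
  forth : p ∣ ℤ.∣ ℤ.+ s ℤ.- i ∣ → p ∣ ℤ.∣ ℤ.+ s ℤ.- ℤ.+ t ∣
  forth s-i = ℤ∣.∣⇒∣ᵤ {P} (subst (P ℤ∣.∣_) (sub (ℤ.+ s) i (ℤ.+ t)) (ℤ∣.∣m∣n⇒∣m-n (fromUnsigned (ℤ.+ s ℤ.- i) s-i) t-i))
    where
    sub : ∀ s i t → (s ℤ.- i) ℤ.- (t ℤ.- i) ≡ s ℤ.- t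
    sub = ℤRing.solve-∀
  back : p ∣ ℤ.∣ ℤ.+ s ℤ.- ℤ.+ t ∣ → p ∣ ℤ.∣ ℤ.+ s ℤ.- i ∣
  back s-t = ℤ∣.∣⇒∣ᵤ {P} (subst (P ℤ∣.∣_) (add (ℤ.+ s) i (ℤ.+ t)) (ℤ∣.∣m∣n⇒∣m+n (fromUnsigned (ℤ.+ s ℤ.- ℤ.+ t) s-t) t-i))
    where
    add : ∀ s i t → (s ℤ.- t) ℤ.+ (t ℤ.- i) ≡ s ℤ.- i
    add = ℤRing.solve-∀

e-residue : ∀ n k i t p → p ∣ ℤ.∣ ℤ.+ t ℤ.- i ∣ → e n k i p ≡ e n k (ℤ.+ t) p
e-residue n k i t p t≡i = begin
  e n k i p                                                ≡⟨ e-gauss n k i p ⟩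
  coeffSumBy (congruentTo p i) (tri k) (gauss n k)         ≡⟨ coeffSumBy-cong (congruentTo-cong p i t t≡i) (tri k) (gauss n k) ⟩
  coeffSumBy (congruentTo p (ℤ.+ t)) (tri k) (gauss n k)   ≡⟨ sym (e-gauss n k (ℤ.+ t) p) ⟩
  e n k (ℤ.+ t) p ∎
  where open ≡-Reasoning

proposition5p2 : (p : ℕ) .{{_ : NonZero p}} →
    ((∀ k → Σ ℤ (λ i → ∀ n → L n k 0 p ≡ e n k i p)) × (∀ n → L n n 0 p ≡ 1))
    × (∀ (a : ℕ → ℕ → ℕ) →
         (∀ k → Σ ℤ (λ i → ∀ n → a n k ≡ e n k i p)) →
         (∀ n → a n n ≡ 1) →
         ∀ n k → a n k ≡ L n k 0 p)
proposition5p2 p = ((λ k → ℤ.+ tri k , λ n → L-column p n k) , L-diagonal p) , unique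
  where
  -- Column k of a is e(·,k,i,p); the diagonal entry forces i ≡ T_k, so it equals L(·,k,0,p).
  unique : ∀ (a : ℕ → ℕ → ℕ) → (∀ k → Σ ℤ (λ i → ∀ n → a n k ≡ e n k i p)) →
           (∀ n → a n n ≡ 1) → ∀ n k → a n k ≡ L n k 0 p
  unique a column diagonal n k = begin
    a n k                   ≡⟨ a≡e n ⟩
    e n k i p               ≡⟨ e-residue n k i (tri k) p i≡T ⟩
    e n k (ℤ.+ tri k) p     ≡⟨ sym (L-column p n k) ⟩
    L n k 0 p ∎
    where
    open ≡-Reasoning
    i = proj₁ (column k)
    a≡e = proj₂ (column k)
    i≡T : p ∣ ℤ.∣ ℤ.+ tri k ℤ.- i ∣
    i≡T = e-diagonal⇒congruent k i p (trans (sym (a≡e k)) (diagonal k))
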